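{- Let $p\equiv 1\pmod 4$ be a prime and $t=\prod_{x=1}^{(p-1)/2}x$. Let $\gamma(t,p)$ be the number of pairs $(i,j)$ with $1\le i<j\le (p-1)/2$ and $\widetilde{ti}>\widetilde{tj}$. Let $X=\{(a,b)\in V\times V : a<b<\overline{a}<\overline{b}\}$ and $Z=\{(a,b)\in V\times V : a<b<\overline{b}<\overline{a}\}$. Then $\gamma(t,p)=4|Z|+2|X|+(p-1)/4$.
   Context: For an integer $x$, $\{x\}_p$ denotes the least nonnegative residue of $x$ modulo $p$, and $\widetilde{x}=p-\{x\}_p$ if $\{x\}_p>p/2$, while $\widetilde{x}=\{x\}_p$ if $\{x\}_p<p/2$. Let $V=\{x : 1\le x\le (p-1)/2,\ x<\widetilde{tx}\}$, and for $a\in V$ put $\overline{a}=\widetilde{ta}$. -}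

module Defs where

open import Data.Nat using (ℕ; zero; suc; _+_; _*_; _∸_; _<_; _<ᵇ_; NonZero)
open import Data.Nat.DivMod using (_%_; _/_)
open import Data.Nat using (_!)
open import Data.Bool using (Bool; true; false; if_then_else_; _∧_)
open import Data.List using (List; length; filter; upTo; map; concatMap; [_]; [])
open import Data.List.Relation.Unary.All using ()
open import Data.Product using (_×_; _,_)
open import Relation.Nullary.Decidable using (Dec; yes; no; _×-dec_)
open import Data.Nat using (_<?_)
open import Data.Bool using (T)

residue : (p : ℕ) → .{{NonZero p}} → ℕ → ℕ
residue p x = x % p

-- x~ : p - {x}_p if {x}_p > p/2, else {x}_p   (p odd, so {x}_p ≠ p/2)
tilde : (p : ℕ) → .{{NonZero p}} → ℕ → ℕ
tilde p x = if p <ᵇ 2 * residue p x then p ∸ residue p x else residue p x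

range1 : ℕ → List ℕ
range1 n = map suc (upTo n)

half : ℕ → ℕ
half p = (p ∸ 1) / 2

tfac : ℕ → ℕ
tfac p = (half p) !

pairs : ℕ → List (ℕ × ℕ)
pairs n = concatMap (λ i → map (λ j → (i , j)) (range1 n)) (range1 n)

gamma : (t p : ℕ) → .{{NonZero p}} → ℕ
gamma t p = length (filter (λ { (i , j) → (i <? j) ×-dec (tilde p (t * j) <? tilde p (t * i)) }) (pairs (half p)))

-- V = {x : 1 ≤ x ≤ (p-1)/2, x < tx~}
inV : (t p : ℕ) → .{{NonZero p}} → ℕ → Set
inV t p x = x < tilde p (t * x)

inV? : (t p : ℕ) → .{{_ : NonZero p}} → (x : ℕ) → Dec (inV t p x)
inV? t p x = x <? tilde p (t * x)

bar : (t p : ℕ) → .{{NonZero p}} → ℕ → ℕ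
bar t p a = tilde p (t * a)

VV? : (t p : ℕ) → .{{_ : NonZero p}} → (ab : ℕ × ℕ) → Dec (inV t p (Data.Product.proj₁ ab) × inV t p (Data.Product.proj₂ ab))
VV? t p (a , b) = inV? t p a ×-dec inV? t p b

cardX : (t p : ℕ) → .{{NonZero p}} → ℕ
cardX t p = length (filter (λ { (a , b) → VV? t p (a , b) ×-dec ((a <? b) ×-dec ((b <? bar t p a) ×-dec (bar t p a <? bar t p b))) }) (pairs (half p)))

cardZ : (t p : ℕ) → .{{NonZero p}} → ℕ
cardZ t p = length (filter (λ { (a , b) → VV? t p (a , b) ×-dec ((a <? b) ×-dec ((b <? bar t p b) ×-dec (bar t p b <? bar t p a))) }) (pairs (half p)))

{-# OPTIONS --safe #-}
-- Write h = (p - 1)/2. Wilson's theorem gives (p - 1)! ≡ -1, and (p - 1)! ≡ (-1)ʰ (h!)² (mod p), so for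
-- h even t = h! satisfies t² ≡ -1. Hence σ x = ˜(t x) is a fixed-point-free involution of {1, …, h},
-- and γ(t,p) is its number of inversions. Grouping {1, …, h} into the chords {a, σ a} with a ∈ V,
-- each chord carries one inversion, and two chords {a, σ a}, {b, σ b} with a < b carry 4, 2 or 0
-- inversions according as they are nested (Z), crossing (X) or disjoint. So γ = 4|Z| + 2|X| + |V|,
-- and |V| = h/2 = (p - 1)/4 because σ pairs up {1, …, h}.
module Submission where

open import Algebra.Bundles using (CommutativeSemigroup)
open import Algebra.Core using (Op₂)
import Algebra.Properties.CommutativeSemigroup as CommutativeSemigroupProperties
open import Algebra.Structures using (IsCommutativeMonoid)
open import Data.Bool.Base using (Bool; true; false; if_then_else_; _∧_)
open import Data.List.Base using (List; []; _∷_; _++_; [_]; length; filter; map; upTo; concatMap)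
open import Data.List.Properties using (filter-++; length-++; map-++; map-cong; upTo-∷ʳ)
open import Data.Nat.Base
open import Data.Nat.Coprimality using (Coprime; coprime?; coprime-Bézout)
open import Data.Nat.Divisibility using (_∣_; m%n≡0⇒n∣m; n∣m⇒m%n≡0; ∣⇒≤)
open import Data.Nat.DivMod
  using (_%_; _/_; m≡m%n+[m/n]*n; m*n/n≡m; m%n%n≡m%n; m%n<n; m%n≤n; m<n⇒m%n≡m; n%n≡0; m*n%n≡0;
         %-distribˡ-+; %-distribˡ-*)
open import Data.Nat.GCD using (module Bézout)
open import Data.Nat.ListAction using (sum)
open import Data.Nat.ListAction.Properties using (sum-++)
open import Data.Nat.Primality using (Prime; euclidsLemma; prime⇒irreducible; prime⇒nonTrivial)
open import Data.Nat.Properties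
open import Data.Nat.Solver using (module +-*-Solver)
open import Data.Product.Base using (_×_; _,_; proj₁; proj₂; uncurry)
open import Data.Sum.Base using (_⊎_; inj₁; inj₂; [_,_]′)
open import Function.Base using (_∘_)
open import Level using (0ℓ)
open import Relation.Binary.Bundles using (Setoid)
import Relation.Binary.Construct.On as On
open import Relation.Binary.Core using (Rel)
open import Relation.Binary.Definitions using (tri<; tri≈; tri>)
open import Relation.Binary.PropositionalEquality
  using (_≡_; _≢_; refl; sym; trans; cong; cong₂; subst; subst₂; setoid; module ≡-Reasoning)
import Relation.Binary.Reasoning.Setoid as SetoidReasoning
open import Relation.Nullary.Decidable using (does; yes; no; dec-true; dec-false)
open import Relation.Nullary.Negation using (¬_; contradiction)
open import Relation.Nullary.Reflects using (Reflects; ofʸ; ofⁿ; fromEquivalence)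
open import Relation.Unary using (Pred; Decidable)

open import Defs

infix 4 _∈[1,_]
_∈[1,_] : ℕ → ℕ → Set
i ∈[1, n ] = 1 ≤ i × i ≤ n

∈[1,suc] : ∀ {i n} → i ∈[1, n ] → i ∈[1, suc n ]
∈[1,suc] (l , u) = l , m≤n⇒m≤1+n u

≡ᵇ-reflects-≡ : ∀ m n → Reflects (m ≡ n) (m ≡ᵇ n)
≡ᵇ-reflects-≡ m n = fromEquivalence (≡ᵇ⇒≡ m n) (≡⇒≡ᵇ m n)

<ᵇ-true : ∀ {m n} → m < n → (m <ᵇ n) ≡ true
<ᵇ-true {m} {n} m<n = dec-true (m <? n) m<n

<ᵇ-false : ∀ {m n} → n < m → (m <ᵇ n) ≡ false
<ᵇ-false {m} {n} n<m = dec-false (m <? n) (<⇒≯ n<m)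

<ᵇ-irrefl : ∀ m → (m <ᵇ m) ≡ false
<ᵇ-irrefl m = dec-false (m <? m) (<-irrefl refl)

≡ᵇ-refl : ∀ m → (m ≡ᵇ m) ≡ true
≡ᵇ-refl m = dec-true (m ≟ m) refl

≡ᵇ-false : ∀ {m n} → m ≢ n → (m ≡ᵇ n) ≡ false
≡ᵇ-false {m} {n} m≢n = dec-false (m ≟ n) m≢n

record IsInvolutionOn (n : ℕ) (σ : ℕ → ℕ) : Set where
  field
    maps-into  : ∀ {i} → i ∈[1, n ] → σ i ∈[1, n ]
    involutive : ∀ {i} → i ∈[1, n ] → σ (σ i) ≡ i

  ≡ᵇ-swap : ∀ {i j} → i ∈[1, n ] → j ∈[1, n ] → (j ≡ᵇ σ i) ≡ (i ≡ᵇ σ j)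
  ≡ᵇ-swap {i} {j} i∈ j∈
    with j ≡ᵇ σ i | ≡ᵇ-reflects-≡ j (σ i) | i ≡ᵇ σ j | ≡ᵇ-reflects-≡ i (σ j)
  ... | true  | _        | true  | _        = refl
  ... | false | _        | false | _        = refl
  ... | true  | ofʸ j≡σi | false | ofⁿ i≢σj =
    contradiction (trans (sym (involutive i∈)) (cong σ (sym j≡σi))) i≢σj
  ... | false | ofⁿ j≢σi | true  | ofʸ i≡σj =
    contradiction (trans (sym (involutive j∈)) (cong σ (sym i≡σj))) j≢σi

record IsFixedPointFreeInvolutionOn (n : ℕ) (σ : ℕ → ℕ) : Set where
  field
    isInvolutionOn : IsInvolutionOn n σ
    fixedPointFree : ∀ {i} → i ∈[1, n ] → σ i ≢ i

  open IsInvolutionOn isInvolutionOn public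

2*m≡m+m : ∀ m → 2 * m ≡ m + m
2*m≡m+m m = cong (m +_) (+-identityʳ m)

m+m≡n+n⇒m≡n : ∀ {m n} → m + m ≡ n + n → m ≡ n
m+m≡n+n⇒m≡n {m} {n} eq = *-cancelˡ-≡ m n 2 (trans (2*m≡m+m m) (trans eq (sym (2*m≡m+m n))))

m+m≤1+n+n⇒m≤n : ∀ {m n} → m + m ≤ suc (n + n) → m ≤ n
m+m≤1+n+n⇒m≤n {m} {n} m+m≤ =
  ≮⇒≥ (λ n<m → <⇒≱ (s≤s (≤-reflexive (sym (+-suc n n)))) (≤-trans (+-mono-≤ n<m n<m) m+m≤))

1+n+n<m+m⇒n<m : ∀ {m n} → suc (n + n) < m + m → n < m
1+n+n<m+m⇒n<m {m} {n} lt = ≰⇒> (λ m≤n → <⇒≱ lt (≤-trans (+-mono-≤ m≤n m≤n) (n≤1+n (n + n))))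

module IteratedOp {a} {A : Set a} {_∙_ : Op₂ A} {ε : A}
                  (isCommutativeMonoid : IsCommutativeMonoid _≡_ _∙_ ε) where

  open IsCommutativeMonoid isCommutativeMonoid using (assoc; identityˡ; identityʳ; isCommutativeSemigroup)

  private
    commutativeSemigroup : CommutativeSemigroup a a
    commutativeSemigroup = record { isCommutativeSemigroup = isCommutativeSemigroup }

  open CommutativeSemigroupProperties commutativeSemigroup using (interchange)

  fold : ℕ → (ℕ → A) → A
  fold zero    f = ε
  fold (suc n) f = fold n f ∙ f (suc n)

  when : Bool → A → A
  when b x = if b then x else ε

  when-∙ : ∀ b x y → when b x ∙ when b y ≡ when b (x ∙ y)
  when-∙ true  x y = refl
  when-∙ false x y = identityˡ ε

  when-ε : ∀ b → when b ε ≡ ε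
  when-ε true  = refl
  when-ε false = refl

  when-idem : ∀ b x → when b (when b x) ≡ when b x
  when-idem true  x = refl
  when-idem false x = refl

  when-<ᵇ-split : ∀ {m n} → m ≢ n → ∀ x → x ≡ when (m <ᵇ n) x ∙ when (n <ᵇ m) x
  when-<ᵇ-split {m} {n} m≢n x with m <ᵇ n | <ᵇ-reflects-< m n | n <ᵇ m | <ᵇ-reflects-< n m
  ... | true  | ofʸ m<n | true  | ofʸ n<m = contradiction n<m (<-asym m<n)
  ... | true  | _       | false | _       = sym (identityʳ x)
  ... | false | _       | true  | _       = sym (identityˡ x)
  ... | false | ofⁿ m≮n | false | ofⁿ n≮m = contradiction (≤-antisym (≮⇒≥ n≮m) (≮⇒≥ m≮n)) m≢n

  when-trichotomy : ∀ m n x → x ≡ (when (m <ᵇ n) x ∙ when (n <ᵇ m) x) ∙ when (n ≡ᵇ m) x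
  when-trichotomy m n x with <-cmp m n
  ... | tri< m<n m≢n _ rewrite <ᵇ-true m<n | <ᵇ-false m<n | ≡ᵇ-false (m≢n ∘ sym) =
    sym (trans (identityʳ _) (identityʳ x))
  ... | tri≈ _ refl _ rewrite <ᵇ-irrefl m | ≡ᵇ-refl m =
    sym (trans (cong (_∙ x) (identityˡ ε)) (identityˡ x))
  ... | tri> _ m≢n n<m rewrite <ᵇ-false n<m | <ᵇ-true n<m | ≡ᵇ-false (m≢n ∘ sym) =
    sym (trans (identityʳ _) (identityˡ x))

  fold-cong : ∀ n {f g} → (∀ {i} → i ∈[1, n ] → f i ≡ g i) → fold n f ≡ fold n g
  fold-cong zero    f≗g = refl
  fold-cong (suc n) f≗g = cong₂ _∙_ (fold-cong n (f≗g ∘ ∈[1,suc])) (f≗g (s≤s z≤n , ≤-refl))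

  fold-ε : ∀ n → fold n (λ _ → ε) ≡ ε
  fold-ε zero    = refl
  fold-ε (suc n) = trans (identityʳ _) (fold-ε n)

  when-fold : ∀ b n f → when b (fold n f) ≡ fold n (λ i → when b (f i))
  when-fold true  n f = refl
  when-fold false n f = sym (fold-ε n)

  fold-∙ : ∀ n f g → fold n (λ i → f i ∙ g i) ≡ fold n f ∙ fold n g
  fold-∙ zero    f g = sym (identityˡ ε)
  fold-∙ (suc n) f g = trans (cong (_∙ (f (suc n) ∙ g (suc n))) (fold-∙ n f g))
                             (interchange (fold n f) (fold n g) (f (suc n)) (g (suc n)))

  fold-comm : ∀ m n (f : ℕ → ℕ → A) →
              fold m (λ i → fold n (f i)) ≡ fold n (λ j → fold m (λ i → f i j))
  fold-comm zero    n f = sym (fold-ε n)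
  fold-comm (suc m) n f = trans (cong (_∙ fold n (f (suc m))) (fold-comm m n f))
                                (sym (fold-∙ n (λ j → fold m (λ i → f i j)) (f (suc m))))

  fold-split : ∀ m n f → fold (m + n) f ≡ fold m f ∙ fold n (λ i → f (m + i))
  fold-split m zero    f = trans (cong (λ k → fold k f) (+-identityʳ m)) (sym (identityʳ _))
  fold-split m (suc n) f = begin
    fold (m + suc n) f                                      ≡⟨ cong (λ k → fold k f) (+-suc m n) ⟩
    fold (m + n) f ∙ f (suc (m + n))                        ≡⟨ cong (_∙ f (suc (m + n))) (fold-split m n f) ⟩
    (fold m f ∙ fold n (λ i → f (m + i))) ∙ f (suc (m + n)) ≡⟨ assoc _ _ _ ⟩
    fold m f ∙ (fold n (λ i → f (m + i)) ∙ f (suc (m + n)))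
      ≡⟨ cong (λ k → fold m f ∙ (fold n (λ i → f (m + i)) ∙ f k)) (+-suc m n) ⟨
    fold m f ∙ fold (suc n) (λ i → f (m + i))               ∎
    where open ≡-Reasoning

  fold-δ : ∀ n {k} (g : ℕ → A) → k ∈[1, n ] → fold n (λ j → when (j ≡ᵇ k) (g j)) ≡ g k
  fold-δ zero    g (s≤s _ , ())
  fold-δ (suc n) {k} g (l , u) with suc n ≡ᵇ k | ≡ᵇ-reflects-≡ (suc n) k
  ... | true  | ofʸ refl = trans (cong (_∙ g k) (trans (fold-cong n elsewhere) (fold-ε n))) (identityˡ _)
    where
    elsewhere : ∀ {j} → j ∈[1, n ] → when (j ≡ᵇ suc n) (g j) ≡ ε
    elsewhere {j} (_ , j≤n) with j ≡ᵇ suc n | ≡ᵇ-reflects-≡ j (suc n)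
    ... | true  | ofʸ refl = contradiction j≤n (<-irrefl refl)
    ... | false | _        = refl
  ... | false | ofⁿ sucn≢k = trans (identityʳ _) (fold-δ n g (l , ≤-pred (≤∧≢⇒< u (sucn≢k ∘ sym))))

  module _ {n σ} (σ-inv : IsInvolutionOn n σ) where
    open IsInvolutionOn σ-inv

    -- f (σ i) is the fold over j of [j = σ i] f j; exchange the folds and use [j = σ i] = [i = σ j].
    fold-reindex : ∀ f → fold n (f ∘ σ) ≡ fold n f
    fold-reindex f = begin
      fold n (f ∘ σ)
        ≡⟨ fold-cong n (λ i∈ → fold-δ n f (maps-into i∈)) ⟨
      fold n (λ i → fold n (λ j → when (j ≡ᵇ σ i) (f j)))
        ≡⟨ fold-comm n n (λ i j → when (j ≡ᵇ σ i) (f j)) ⟩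
      fold n (λ j → fold n (λ i → when (j ≡ᵇ σ i) (f j)))
        ≡⟨ fold-cong n (λ {j} j∈ → fold-cong n (λ i∈ → cong (λ b → when b (f j)) (≡ᵇ-swap i∈ j∈))) ⟩
      fold n (λ j → fold n (λ i → when (i ≡ᵇ σ j) (f j)))
        ≡⟨ fold-cong n (λ {j} j∈ → fold-δ n (λ _ → f j) (maps-into j∈)) ⟩
      fold n f
        ∎
      where open ≡-Reasoning

  -- f i is charged to the smaller of i and σ i; reindexing by σ brings the two halves together.
  fold-pairUp : ∀ {n σ} → IsFixedPointFreeInvolutionOn n σ → ∀ f →
                fold n f ≡ fold n (λ i → when (i <ᵇ σ i) (f i ∙ f (σ i)))
  fold-pairUp {n} {σ} σ-inv f = begin
    fold n f                              ≡⟨ fold-cong n split ⟩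
    fold n (λ i → first i ∙ second (σ i)) ≡⟨ fold-∙ n first (second ∘ σ) ⟩
    fold n first ∙ fold n (second ∘ σ)    ≡⟨ cong (fold n first ∙_) (fold-reindex isInvolutionOn second) ⟩
    fold n first ∙ fold n second          ≡⟨ fold-∙ n first second ⟨
    fold n (λ i → first i ∙ second i)     ≡⟨ fold-cong n (λ {i} _ → when-∙ (i <ᵇ σ i) (f i) (f (σ i))) ⟩
    fold n (λ i → when (i <ᵇ σ i) (f i ∙ f (σ i))) ∎
    where
    open ≡-Reasoning
    open IsFixedPointFreeInvolutionOn σ-inv
    first second : ℕ → A
    first  i = when (i <ᵇ σ i) (f i)
    second k = when (k <ᵇ σ k) (f (σ k))
    split : ∀ {i} → i ∈[1, n ] → f i ≡ first i ∙ second (σ i)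
    split {i} i∈ = trans (when-<ᵇ-split (fixedPointFree i∈ ∘ sym) (f i))
                         (cong (λ k → first i ∙ when (σ i <ᵇ k) (f k)) (sym (involutive i∈)))

module Sum where

  open IteratedOp +-0-isCommutativeMonoid public
    renaming ( fold to ∑; fold-cong to ∑-cong; fold-∙ to ∑-distrib-+; fold-comm to ∑-comm; fold-δ to ∑-δ
             ; fold-reindex to ∑-reindex; fold-pairUp to ∑-pairUp; when-∙ to when-+; when-fold to when-∑)

  ⟦_⟧ : Bool → ℕ
  ⟦ b ⟧ = when b 1

  ∑∑ : ℕ → (ℕ → ℕ → ℕ) → ℕ
  ∑∑ n g = ∑ n (λ a → ∑ n (g a))

  ∑∑-cong : ∀ n {f g} → (∀ {a b} → a ∈[1, n ] → b ∈[1, n ] → f a b ≡ g a b) → ∑∑ n f ≡ ∑∑ n g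
  ∑∑-cong n f≗g = ∑-cong n (λ a∈ → ∑-cong n (f≗g a∈))

  ∑∑-distrib-+ : ∀ n f g → ∑∑ n (λ a b → f a b + g a b) ≡ ∑∑ n f + ∑∑ n g
  ∑∑-distrib-+ n f g = trans (∑-cong n (λ {a} _ → ∑-distrib-+ n (f a) (g a))) (∑-distrib-+ n _ _)

  ∑-*ˡ : ∀ n c f → ∑ n (λ i → c * f i) ≡ c * ∑ n f
  ∑-*ˡ zero    c f = sym (*-zeroʳ c)
  ∑-*ˡ (suc n) c f = trans (cong (_+ c * f (suc n)) (∑-*ˡ n c f)) (sym (*-distribˡ-+ c _ _))

  ∑∑-*ˡ : ∀ n c f → ∑∑ n (λ a b → c * f a b) ≡ c * ∑∑ n f
  ∑∑-*ˡ n c f = trans (∑-cong n (λ {a} _ → ∑-*ˡ n c (f a))) (∑-*ˡ n c _)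

  ∑-1 : ∀ n → ∑ n (λ _ → 1) ≡ n
  ∑-1 zero    = refl
  ∑-1 (suc n) = trans (cong (_+ 1) (∑-1 n)) (+-comm n 1)

  ∑∑-diagonal-split : ∀ n g →
    ∑∑ n g ≡ ∑∑ n (λ a b → when (a <ᵇ b) (g a b + g b a)) + ∑ n (λ a → g a a)
  ∑∑-diagonal-split n g = begin
    ∑∑ n g
      ≡⟨ ∑∑-cong n (λ {a} {b} _ _ → when-trichotomy a b (g a b)) ⟩
    ∑∑ n (λ a b → above a b + when (b <ᵇ a) (g a b) + when (b ≡ᵇ a) (g a b))
      ≡⟨ ∑∑-distrib-+ n _ _ ⟩
    ∑∑ n (λ a b → above a b + when (b <ᵇ a) (g a b)) + ∑∑ n (λ a b → when (b ≡ᵇ a) (g a b))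
      ≡⟨ cong₂ _+_ (∑∑-distrib-+ n _ _) (∑-cong n (λ {a} a∈ → ∑-δ n (g a) a∈)) ⟩
    ∑∑ n above + ∑∑ n (λ a b → when (b <ᵇ a) (g a b)) + diagonal
      ≡⟨ cong (λ s → ∑∑ n above + s + diagonal) (∑-comm n n (λ a b → when (b <ᵇ a) (g a b))) ⟩
    ∑∑ n above + ∑∑ n (λ a b → when (a <ᵇ b) (g b a)) + diagonal
      ≡⟨ cong (_+ diagonal) (∑∑-distrib-+ n _ _) ⟨
    ∑∑ n (λ a b → above a b + when (a <ᵇ b) (g b a)) + diagonal
      ≡⟨ cong (_+ diagonal) (∑∑-cong n (λ {a} {b} _ _ → when-+ (a <ᵇ b) (g a b) (g b a))) ⟩
    ∑∑ n (λ a b → when (a <ᵇ b) (g a b + g b a)) + diagonal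
      ∎
    where
    open ≡-Reasoning
    above : ℕ → ℕ → ℕ
    above a b = when (a <ᵇ b) (g a b)
    diagonal : ℕ
    diagonal = ∑ n (λ a → g a a)

module Product where

  open IteratedOp *-1-isCommutativeMonoid public
    renaming ( fold to ∏; fold-cong to ∏-cong; fold-ε to ∏-1; fold-split to ∏-split
             ; fold-reindex to ∏-reindex; fold-pairUp to ∏-pairUp)

  n!≡∏ : ∀ n → n ! ≡ ∏ n (λ i → i)
  n!≡∏ zero    = refl
  n!≡∏ (suc n) = trans (*-comm (suc n) (n !)) (cong (_* suc n) (n!≡∏ n))

module FilterLength {A : Set} {ℓ} {P : Pred A ℓ} (P? : Decidable P) where

  open Sum

  length-filter-concatMap : ∀ {B : Set} (g : B → List A) xs →
    length (filter P? (concatMap g xs)) ≡ sum (map (λ x → length (filter P? (g x))) xs)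
  length-filter-concatMap g []       = refl
  length-filter-concatMap g (x ∷ xs) = begin
    length (filter P? (g x ++ concatMap g xs))                     ≡⟨ cong length (filter-++ P? (g x) _) ⟩
    length (filter P? (g x) ++ filter P? (concatMap g xs))         ≡⟨ length-++ (filter P? (g x)) ⟩
    length (filter P? (g x)) + length (filter P? (concatMap g xs))
      ≡⟨ cong (length (filter P? (g x)) +_) (length-filter-concatMap g xs) ⟩
    length (filter P? (g x)) + sum (map (λ x → length (filter P? (g x))) xs) ∎
    where open ≡-Reasoning

  length-filter-map : ∀ {B : Set} (g : B → A) xs →
    length (filter P? (map g xs)) ≡ sum (map (λ x → ⟦ does (P? (g x)) ⟧) xs)
  length-filter-map g []       = refl
  length-filter-map g (x ∷ xs) with does (P? (g x))
  ... | true  = cong suc (length-filter-map g xs)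
  ... | false = length-filter-map g xs

sum-map-range1 : ∀ f n → sum (map f (range1 n)) ≡ Sum.∑ n f
sum-map-range1 f zero    = refl
sum-map-range1 f (suc n) = begin
  sum (map f (map suc (upTo (suc n))))     ≡⟨ cong (sum ∘ map f ∘ map suc) (upTo-∷ʳ n) ⟨
  sum (map f (map suc (upTo n ++ [ n ])))  ≡⟨ cong (sum ∘ map f) (map-++ suc (upTo n) [ n ]) ⟩
  sum (map f (range1 n ++ [ suc n ]))      ≡⟨ cong sum (map-++ f (range1 n) [ suc n ]) ⟩
  sum (map f (range1 n) ++ [ f (suc n) ])  ≡⟨ sum-++ (map f (range1 n)) [ f (suc n) ] ⟩
  sum (map f (range1 n)) + (f (suc n) + 0) ≡⟨ cong₂ _+_ (sum-map-range1 f n) (+-identityʳ _) ⟩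
  Sum.∑ n f + f (suc n)                    ∎
  where open ≡-Reasoning

length-filter-pairs : ∀ {ℓ} {P : Pred (ℕ × ℕ) ℓ} (P? : Decidable P) n →
  length (filter P? (pairs n)) ≡ Sum.∑∑ n (λ i j → Sum.⟦ does (P? (i , j)) ⟧)
length-filter-pairs P? n = begin
  length (filter P? (pairs n))
    ≡⟨ length-filter-concatMap (λ i → map (i ,_) (range1 n)) (range1 n) ⟩
  sum (map (λ i → length (filter P? (map (i ,_) (range1 n)))) (range1 n))
    ≡⟨ cong sum (map-cong (λ i → trans (length-filter-map (i ,_) (range1 n)) (sum-map-range1 _ n))
                          (range1 n)) ⟩
  sum (map (λ i → ∑ n (λ j → ⟦ does (P? (i , j)) ⟧)) (range1 n))
    ≡⟨ sum-map-range1 _ n ⟩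
  ∑∑ n (λ i j → ⟦ does (P? (i , j)) ⟧) ∎
  where
  open ≡-Reasoning
  open Sum
  open FilterLength P?

module Chords where

  open Sum

  inversion : ℕ → ℕ → ℕ → ℕ → ℕ
  inversion x x′ y y′ = ⟦ (x <ᵇ y) ∧ (y′ <ᵇ x′) ⟧

  chordInversions : ℕ → ℕ → ℕ → ℕ → ℕ
  chordInversions a A b B = (inversion a A b B + inversion A a b B) + (inversion a A B b + inversion A a B b)

  chordInversions-self : ∀ {a A} → a ≢ A → when (a <ᵇ A) (chordInversions a A a A) ≡ ⟦ a <ᵇ A ⟧
  chordInversions-self {a} {A} a≢A with <-cmp a A
  ... | tri< a<A _ _ rewrite <ᵇ-irrefl a | <ᵇ-irrefl A | <ᵇ-true a<A | <ᵇ-false a<A = refl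
  ... | tri≈ _ a≡A _ = contradiction a≡A a≢A
  ... | tri> _ _ A<a rewrite <ᵇ-false A<a = refl

  chordInversions-pair : ∀ {a A b B} → a < A → b < B → A ≢ b → (A ≡ B → a ≡ b) →
    when (a <ᵇ b) (chordInversions a A b B + chordInversions b B a A)
      ≡ 4 * ⟦ (a <ᵇ b) ∧ (B <ᵇ A) ⟧ + 2 * ⟦ (a <ᵇ b) ∧ ((b <ᵇ A) ∧ (A <ᵇ B)) ⟧
  chordInversions-pair {a} {A} {b} {B} a<A b<B A≢b A≡B⇒a≡b with <-cmp a b
  ... | tri≈ _ refl _ rewrite <ᵇ-irrefl a = refl
  ... | tri> _ _ b<a  rewrite <ᵇ-false b<a = refl
  ... | tri< a<b _ _  with <-cmp b A | <-cmp A B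
  ...   | tri≈ _ b≡A _ | _            = contradiction (sym b≡A) A≢b
  ...   | tri< _ _ _   | tri≈ _ A≡B _ = contradiction (A≡B⇒a≡b A≡B) (<⇒≢ a<b)
  ...   | tri> _ _ A<b | _
    rewrite <ᵇ-true a<b | <ᵇ-false a<b | <ᵇ-true A<b | <ᵇ-false A<b
          | <ᵇ-true (<-trans a<b b<B) | <ᵇ-false (<-trans a<b b<B)
          | <ᵇ-true (<-trans A<b b<B) | <ᵇ-false (<-trans A<b b<B) = refl
  ...   | tri< b<A _ _ | tri< A<B _ _
    rewrite <ᵇ-true a<b | <ᵇ-false a<b | <ᵇ-true b<A | <ᵇ-false b<A
          | <ᵇ-true A<B | <ᵇ-false A<B | <ᵇ-true (<-trans a<b b<B) | <ᵇ-false (<-trans a<b b<B) = refl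
  ...   | tri< b<A _ _ | tri> _ _ B<A
    rewrite <ᵇ-true a<b | <ᵇ-false a<b | <ᵇ-true b<A | <ᵇ-false b<A
          | <ᵇ-true B<A | <ᵇ-false B<A | <ᵇ-true (<-trans a<b b<B) | <ᵇ-false (<-trans a<b b<B) = refl

module InvolutionInversions {h σ} (σ-inv : IsFixedPointFreeInvolutionOn h σ) where

  open IsFixedPointFreeInvolutionOn σ-inv
  open Sum
  open Chords

  -- For σ x = ˜(t x): inVᵇ decides membership in V, and ∑∑ h inverted, ∑∑ h nested, ∑∑ h crossing
  -- and cardV are γ(t,p), |Z|, |X| and |V|.
  inverted : ℕ → ℕ → ℕ
  inverted i j = inversion i (σ i) j (σ j)

  inVᵇ : ℕ → Bool
  inVᵇ a = a <ᵇ σ a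

  nested crossing : ℕ → ℕ → ℕ
  nested   a b = ⟦ (inVᵇ a ∧ inVᵇ b) ∧ ((a <ᵇ b) ∧ ((b <ᵇ σ b) ∧ (σ b <ᵇ σ a))) ⟧
  crossing a b = ⟦ (inVᵇ a ∧ inVᵇ b) ∧ ((a <ᵇ b) ∧ ((b <ᵇ σ a) ∧ (σ a <ᵇ σ b))) ⟧

  cardV : ℕ
  cardV = ∑ h (⟦_⟧ ∘ inVᵇ)

  chordInversionsV : ℕ → ℕ → ℕ
  chordInversionsV a b = when (inVᵇ a) (when (inVᵇ b) (chordInversions a (σ a) b (σ b)))

  orbitInversions : ℕ → ℕ → ℕ
  orbitInversions a b = (inverted a b + inverted (σ a) b) + (inverted a (σ b) + inverted (σ a) (σ b))

  orbitInversions≡chordInversions : ∀ {a b} → a ∈[1, h ] → b ∈[1, h ] →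
    orbitInversions a b ≡ chordInversions a (σ a) b (σ b)
  orbitInversions≡chordInversions {a} {b} a∈ b∈ = cong₂ (λ a′ b′ →
      (inversion a (σ a) b (σ b) + inversion (σ a) a′ b (σ b))
        + (inversion a (σ a) (σ b) b′ + inversion (σ a) a′ (σ b) b′))
    (involutive a∈) (involutive b∈)

  ∑∑-inverted≡∑∑-chordInversionsV : ∑∑ h inverted ≡ ∑∑ h chordInversionsV
  ∑∑-inverted≡∑∑-chordInversionsV = begin
    ∑ h (λ i → ∑ h (inverted i))
      ≡⟨ ∑-pairUp σ-inv _ ⟩
    ∑ h (λ a → when (inVᵇ a) (∑ h (inverted a) + ∑ h (inverted (σ a))))
      ≡⟨ ∑-cong h (λ {a} _ → cong (when (inVᵇ a)) (∑-distrib-+ h (inverted a) (inverted (σ a)))) ⟨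
    ∑ h (λ a → when (inVᵇ a) (∑ h (λ j → inverted a j + inverted (σ a) j)))
      ≡⟨ ∑-cong h (λ {a} _ → cong (when (inVᵇ a)) (∑-pairUp σ-inv _)) ⟩
    ∑ h (λ a → when (inVᵇ a) (∑ h (λ b → when (inVᵇ b) (orbitInversions a b))))
      ≡⟨ ∑-cong h (λ {a} a∈ → trans (when-∑ (inVᵇ a) h _) (∑-cong h (λ {b} b∈ →
           cong (when (inVᵇ a) ∘ when (inVᵇ b)) (orbitInversions≡chordInversions a∈ b∈)))) ⟩
    ∑∑ h chordInversionsV ∎
    where open ≡-Reasoning

  chordInversionsV-self : ∀ {a} → a ∈[1, h ] → chordInversionsV a a ≡ ⟦ inVᵇ a ⟧
  chordInversionsV-self {a} a∈ = trans (when-idem (inVᵇ a) _) (chordInversions-self (fixedPointFree a∈ ∘ sym))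

  chordInversionsV-pair : ∀ {a b} → a ∈[1, h ] → b ∈[1, h ] →
    when (a <ᵇ b) (chordInversionsV a b + chordInversionsV b a) ≡ 4 * nested a b + 2 * crossing a b
  chordInversionsV-pair {a} {b} a∈ b∈ with inVᵇ a | <ᵇ-reflects-< a (σ a) | inVᵇ b | <ᵇ-reflects-< b (σ b)
  ... | true  | ofʸ a<σa | true  | ofʸ b<σb = chordInversions-pair a<σa b<σb σa≢b σ-injective
    where
    σa≢b : σ a ≢ b
    σa≢b σa≡b = <-asym (subst (a <_) σa≡b a<σa)
                       (subst (b <_) (trans (cong σ (sym σa≡b)) (involutive a∈)) b<σb)
    σ-injective : σ a ≡ σ b → a ≡ b
    σ-injective σa≡σb = trans (sym (involutive a∈)) (trans (cong σ σa≡σb) (involutive b∈))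
  ... | true  | _ | false | _ = when-ε (a <ᵇ b)
  ... | false | _ | true  | _ = when-ε (a <ᵇ b)
  ... | false | _ | false | _ = when-ε (a <ᵇ b)

  cardV+cardV : cardV + cardV ≡ h
  cardV+cardV = begin
    cardV + cardV                              ≡⟨ cong (cardV +_) (∑-reindex isInvolutionOn (⟦_⟧ ∘ inVᵇ)) ⟨
    cardV + ∑ h (⟦_⟧ ∘ inVᵇ ∘ σ)                ≡⟨ ∑-distrib-+ h (⟦_⟧ ∘ inVᵇ) (⟦_⟧ ∘ inVᵇ ∘ σ) ⟨
    ∑ h (λ a → ⟦ inVᵇ a ⟧ + ⟦ inVᵇ (σ a) ⟧)      ≡⟨ ∑-cong h ⟦inV⟧+⟦inV∘σ⟧≡1 ⟩
    ∑ h (λ _ → 1)                              ≡⟨ ∑-1 h ⟩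
    h                                          ∎
    where
    open ≡-Reasoning
    ⟦inV⟧+⟦inV∘σ⟧≡1 : ∀ {a} → a ∈[1, h ] → ⟦ inVᵇ a ⟧ + ⟦ inVᵇ (σ a) ⟧ ≡ 1
    ⟦inV⟧+⟦inV∘σ⟧≡1 {a} a∈ = sym (trans (when-<ᵇ-split (fixedPointFree a∈ ∘ sym) 1)
                                 (cong (λ a′ → ⟦ inVᵇ a ⟧ + ⟦ σ a <ᵇ a′ ⟧) (sym (involutive a∈))))

  ∑∑-inverted : ∑∑ h inverted ≡ 4 * ∑∑ h nested + 2 * ∑∑ h crossing + cardV
  ∑∑-inverted = begin
    ∑∑ h inverted
      ≡⟨ ∑∑-inverted≡∑∑-chordInversionsV ⟩
    ∑∑ h chordInversionsV
      ≡⟨ ∑∑-diagonal-split h chordInversionsV ⟩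
    ∑∑ h (λ a b → when (a <ᵇ b) (chordInversionsV a b + chordInversionsV b a))
      + ∑ h (λ a → chordInversionsV a a)
      ≡⟨ cong₂ _+_ (∑∑-cong h chordInversionsV-pair) (∑-cong h chordInversionsV-self) ⟩
    ∑∑ h (λ a b → 4 * nested a b + 2 * crossing a b) + cardV
      ≡⟨ cong (_+ cardV) (∑∑-distrib-+ h _ _) ⟩
    ∑∑ h (λ a b → 4 * nested a b) + ∑∑ h (λ a b → 2 * crossing a b) + cardV
      ≡⟨ cong (_+ cardV) (cong₂ _+_ (∑∑-*ˡ h 4 nested) (∑∑-*ˡ h 2 crossing)) ⟩
    4 * ∑∑ h nested + 2 * ∑∑ h crossing + cardV ∎
    where open ≡-Reasoning

module Congruence (p : ℕ) .{{_ : NonZero p}} where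

  infix 4 _≈_ _≉_ _≈±_

  _≈_ : Rel ℕ 0ℓ
  x ≈ y = x % p ≡ y % p

  _≉_ : Rel ℕ 0ℓ
  x ≉ y = ¬ x ≈ y

  ≈-setoid : Setoid 0ℓ 0ℓ
  ≈-setoid = On.setoid (setoid ℕ) (_% p)

  module ≈-Reasoning = SetoidReasoning ≈-setoid

  ≡⇒≈ : ∀ {x y} → x ≡ y → x ≈ y
  ≡⇒≈ = cong (_% p)

  %-≈ : ∀ x → x % p ≈ x
  %-≈ x = m%n%n≡m%n x p

  +-cong : ∀ {a b c d} → a ≈ b → c ≈ d → a + c ≈ b + d
  +-cong {a} {b} {c} {d} a≈b c≈d = begin
    (a + c) % p             ≡⟨ %-distribˡ-+ a c p ⟩
    (a % p + c % p) % p     ≡⟨ cong₂ (λ x y → (x + y) % p) a≈b c≈d ⟩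
    (b % p + d % p) % p     ≡⟨ %-distribˡ-+ b d p ⟨
    (b + d) % p             ∎
    where open ≡-Reasoning

  *-cong : ∀ {a b c d} → a ≈ b → c ≈ d → a * c ≈ b * d
  *-cong {a} {b} {c} {d} a≈b c≈d = begin
    (a * c) % p             ≡⟨ %-distribˡ-* a c p ⟩
    (a % p * (c % p)) % p   ≡⟨ cong₂ (λ x y → (x * y) % p) a≈b c≈d ⟩
    (b % p * (d % p)) % p   ≡⟨ %-distribˡ-* b d p ⟨
    (b * d) % p             ∎
    where open ≡-Reasoning

  +-congˡ : ∀ a {b c} → b ≈ c → a + b ≈ a + c
  +-congˡ a = +-cong {a} refl

  +-congʳ : ∀ {a b} c → a ≈ b → a + c ≈ b + c
  +-congʳ c a≈b = +-cong a≈b (refl {x = c % p})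

  *-congˡ : ∀ a {b c} → b ≈ c → a * b ≈ a * c
  *-congˡ a = *-cong {a} refl

  0%p≡0 : 0 % p ≡ 0
  0%p≡0 = m<n⇒m%n≡m (>-nonZero⁻¹ p)

  *p≈0 : ∀ n → n * p ≈ 0
  *p≈0 n = trans (m*n%n≡0 n p) (sym 0%p≡0)

  p≈0 : p ≈ 0
  p≈0 = trans (n%n≡0 p) (sym 0%p≡0)

  ∣⇒≈0 : ∀ {x} → p ∣ x → x ≈ 0
  ∣⇒≈0 {x} p∣x = trans (n∣m⇒m%n≡0 x p p∣x) (sym 0%p≡0)

  ≈0⇒∣ : ∀ {x} → x ≈ 0 → p ∣ x
  ≈0⇒∣ {x} x≈0 = m%n≡0⇒n∣m x p (trans x≈0 0%p≡0)

  <⇒≈⇒≡ : ∀ {x y} → x < p → y < p → x ≈ y → x ≡ y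
  <⇒≈⇒≡ x<p y<p x≈y = trans (sym (m<n⇒m%n≡m x<p)) (trans x≈y (m<n⇒m%n≡m y<p))

  <⇒≉0 : ∀ {x} → 0 < x → x < p → x ≉ 0
  <⇒≉0 0<x x<p x≈0 = <⇒≢ 0<x (sym (<⇒≈⇒≡ x<p (>-nonZero⁻¹ p) x≈0))

  +-cancelʳ : ∀ {a b} c → a + c ≈ b + c → a ≈ b
  +-cancelʳ {a} {b} c a+c≈b+c = begin
    a                 ≡⟨ +-identityʳ a ⟨
    a + 0             ≈⟨ +-congˡ a c+c′≈0 ⟨
    a + (c + c′)      ≡⟨ +-assoc a c c′ ⟨
    (a + c) + c′      ≈⟨ +-congʳ c′ a+c≈b+c ⟩
    (b + c) + c′      ≡⟨ +-assoc b c c′ ⟩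
    b + (c + c′)      ≈⟨ +-congˡ b c+c′≈0 ⟩
    b + 0             ≡⟨ +-identityʳ b ⟩
    b                 ∎
    where
    open ≈-Reasoning
    c′ : ℕ
    c′ = p ∸ c % p
    c+c′≈0 : c + c′ ≈ 0
    c+c′≈0 = begin
      c + c′          ≈⟨ +-congʳ c′ (%-≈ c) ⟨
      c % p + c′      ≡⟨ m+[n∸m]≡n (m%n≤n c p) ⟩
      p               ≈⟨ p≈0 ⟩
      0               ∎

  _≈±_ : Rel ℕ 0ℓ
  x ≈± y = x ≈ y ⊎ x + y ≈ 0

  ≈±-sym : ∀ {x y} → x ≈± y → y ≈± x
  ≈±-sym         (inj₁ x≈y)   = inj₁ (sym x≈y)
  ≈±-sym {x} {y} (inj₂ x+y≈0) = inj₂ (trans (≡⇒≈ (+-comm y x)) x+y≈0)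

  ≈±-trans : ∀ {x y z} → x ≈± y → y ≈± z → x ≈± z
  ≈±-trans             (inj₁ x≈y)   (inj₁ y≈z)   = inj₁ (trans x≈y y≈z)
  ≈±-trans {z = z}     (inj₁ x≈y)   (inj₂ y+z≈0) = inj₂ (trans (+-congʳ z x≈y) y+z≈0)
  ≈±-trans {x}         (inj₂ x+y≈0) (inj₁ y≈z)   = inj₂ (trans (+-congˡ x (sym y≈z)) x+y≈0)
  ≈±-trans {y = y} {z} (inj₂ x+y≈0) (inj₂ y+z≈0) =
    inj₁ (+-cancelʳ y (trans x+y≈0 (sym (trans (≡⇒≈ (+-comm z y)) y+z≈0))))

  ≈±-*ˡ : ∀ c {x y} → x ≈± y → c * x ≈± c * y
  ≈±-*ˡ c         (inj₁ x≈y)   = inj₁ (*-congˡ c x≈y)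
  ≈±-*ˡ c {x} {y} (inj₂ x+y≈0) =
    inj₂ (trans (≡⇒≈ (sym (*-distribˡ-+ c x y))) (trans (*-congˡ c x+y≈0) (≡⇒≈ (*-zeroʳ c))))

  ≈±-≉0 : ∀ {x y} → y ≉ 0 → x ≈± y → x ≉ 0
  ≈±-≉0     y≉0 (inj₁ x≈y)   x≈0 = y≉0 (trans (sym x≈y) x≈0)
  ≈±-≉0 {y = y} y≉0 (inj₂ x+y≈0) x≈0 = y≉0 (trans (sym (+-congʳ y x≈0)) x+y≈0)

module ProductCongruence (p : ℕ) .{{_ : NonZero p}} where

  open Congruence p
  open Product

  ∏-cong-≈ : ∀ n {f g} → (∀ {i} → i ∈[1, n ] → f i ≈ g i) → ∏ n f ≈ ∏ n g
  ∏-cong-≈ zero    f≈g = refl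
  ∏-cong-≈ (suc n) f≈g = *-cong (∏-cong-≈ n (f≈g ∘ ∈[1,suc])) (f≈g (s≤s z≤n , ≤-refl))

  ∏-≈1 : ∀ n {f} → (∀ {i} → i ∈[1, n ] → f i ≈ 1) → ∏ n f ≈ 1
  ∏-≈1 n f≈1 = trans (∏-cong-≈ n f≈1) (≡⇒≈ (∏-1 n))

  ∸-*-∸ : ∀ {a b} → a ≤ p → b ≤ p → (p ∸ a) * (p ∸ b) ≈ a * b
  ∸-*-∸ {a} {b} a≤p b≤p = begin
    (p ∸ a) * (p ∸ b)                       ≡⟨ +-identityʳ _ ⟨
    (p ∸ a) * (p ∸ b) + 0                   ≈⟨ +-congˡ ((p ∸ a) * (p ∸ b)) (*p≈0 a) ⟨
    (p ∸ a) * (p ∸ b) + a * p               ≡⟨ cong (λ q → (p ∸ a) * (p ∸ b) + a * q) (m∸n+n≡m b≤p) ⟨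
    (p ∸ a) * (p ∸ b) + a * (p ∸ b + b)     ≡⟨ rearrange a (p ∸ a) b (p ∸ b) ⟩
    (p ∸ a + a) * (p ∸ b) + a * b           ≡⟨ cong (λ q → q * (p ∸ b) + a * b) (m∸n+n≡m a≤p) ⟩
    p * (p ∸ b) + a * b                     ≈⟨ +-congʳ (a * b) (trans (≡⇒≈ (*-comm p _)) (*p≈0 (p ∸ b))) ⟩
    a * b                                   ∎
    where
    open ≈-Reasoning
    open +-*-Solver
    rearrange : ∀ a a′ b b′ → a′ * b′ + a * (b′ + b) ≡ (a′ + a) * b′ + a * b
    rearrange = solve 4 (λ a a′ b b′ → a′ :* b′ :+ a :* (b′ :+ b) := (a′ :+ a) :* b′ :+ a :* b) refl

  when-≈1 : ∀ b {x} → x ≈ 1 → when b x ≈ 1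
  when-≈1 true  x≈1 = x≈1
  when-≈1 false x≈1 = refl

  ∏-∸-even : ∀ k → k + k ≤ p → ∏ (k + k) (p ∸_) ≈ ∏ (k + k) (λ i → i)
  ∏-∸-even zero    _      = refl
  ∏-∸-even (suc k) 2k+2≤p = begin
    ∏ (suc k + suc k) (p ∸_)                         ≡⟨ ∏-twoMore (p ∸_) ⟩
    ∏ (k + k) (p ∸_) * ((p ∸ suc (k + k)) * (p ∸ suc (suc (k + k))))
      ≈⟨ *-cong (∏-∸-even k (≤-trans (m≤n+m (k + k) 2) 2k+2≤p′))
                (∸-*-∸ (≤-trans (n≤1+n _) 2k+2≤p′) 2k+2≤p′) ⟩
    ∏ (k + k) (λ i → i) * (suc (k + k) * suc (suc (k + k))) ≡⟨ ∏-twoMore (λ i → i) ⟨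
    ∏ (suc k + suc k) (λ i → i)                      ∎
    where
    open ≈-Reasoning
    2k+2≤p′ : suc (suc (k + k)) ≤ p
    2k+2≤p′ = subst (_≤ p) (cong suc (+-suc k k)) 2k+2≤p
    ∏-twoMore : ∀ f → ∏ (suc k + suc k) f ≡ ∏ (k + k) f * (f (suc (k + k)) * f (suc (suc (k + k))))
    ∏-twoMore f = trans (cong (λ n → ∏ n f) (cong suc (+-suc k k)))
                        (*-assoc (∏ (k + k) f) (f (suc (k + k))) (f (suc (suc (k + k)))))

module ModularInverse (p : ℕ) .{{_ : NonZero p}} (p-prime : Prime p) where

  open Congruence p
  open ≈-Reasoning

  1<p : 1 < p
  1<p = nonTrivial⇒n>1 p {{prime⇒nonTrivial p-prime}}

  1≉0 : 1 ≉ 0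
  1≉0 = <⇒≉0 z<s 1<p

  <p⇒coprime : ∀ {x} → 1 ≤ x → x < p → Coprime x p
  <p⇒coprime {x} 1≤x x<p (d∣x , d∣p) with prime⇒irreducible p-prime d∣p
  ... | inj₁ d≡1 = d≡1
  ... | inj₂ refl = contradiction (∣⇒≤ {{>-nonZero 1≤x}} d∣x) (<⇒≱ x<p)

  bézoutInverse : ∀ {x} → Bézout.Identity 1 x p → ℕ
  bézoutInverse (Bézout.+- a _ _) = a
  bézoutInverse (Bézout.-+ a _ _) = (p ∸ 1) * a

  *-bézoutInverse : ∀ {x} (b : Bézout.Identity 1 x p) → x * bézoutInverse b ≈ 1
  *-bézoutInverse {x} (Bézout.+- a b 1+bp≡ax) = begin
    x * a                   ≡⟨ trans (*-comm x a) (sym 1+bp≡ax) ⟩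
    1 + b * p               ≈⟨ +-congˡ 1 (*p≈0 b) ⟩
    1                       ∎
  *-bézoutInverse {x} (Bézout.-+ a b 1+ax≡bp) = begin
    x * ((p ∸ 1) * a)       ≡⟨ trans (*-comm x ((p ∸ 1) * a)) (*-assoc (p ∸ 1) a x) ⟩
    (p ∸ 1) * (a * x)       ≈⟨ +-cancelʳ (p ∸ 1) (begin
      (p ∸ 1) * (a * x) + (p ∸ 1) ≡⟨ trans (+-comm _ (p ∸ 1)) (sym (*-suc (p ∸ 1) (a * x))) ⟩
      (p ∸ 1) * (1 + a * x)       ≡⟨ cong ((p ∸ 1) *_) 1+ax≡bp ⟩
      (p ∸ 1) * (b * p)           ≈⟨ *-congˡ (p ∸ 1) (*p≈0 b) ⟩
      (p ∸ 1) * 0                 ≡⟨ *-zeroʳ (p ∸ 1) ⟩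
      0                           ≈⟨ p≈0 ⟨
      p                           ≡⟨ m+[n∸m]≡n (>-nonZero⁻¹ p) ⟨
      1 + (p ∸ 1)                 ∎) ⟩
    1                       ∎

  inverse : ℕ → ℕ
  inverse x with coprime? x p
  ... | yes x⊥p = bézoutInverse (coprime-Bézout x⊥p) % p
  ... | no  _   = 0

  inverse<p : ∀ x → inverse x < p
  inverse<p x with coprime? x p
  ... | yes _ = m%n<n _ p
  ... | no  _ = >-nonZero⁻¹ p

  *-inverse : ∀ {x} → 1 ≤ x → x < p → x * inverse x ≈ 1
  *-inverse {x} 1≤x x<p with coprime? x p
  ... | yes x⊥p = trans (*-congˡ x (%-≈ _)) (*-bézoutInverse (coprime-Bézout x⊥p))
  ... | no ¬x⊥p = contradiction (λ {d} → <p⇒coprime 1≤x x<p {d}) ¬x⊥p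

  inverse-unique : ∀ {x y} → 1 ≤ x → x < p → y < p → x * y ≈ 1 → inverse x ≡ y
  inverse-unique {x} {y} 1≤x x<p y<p xy≈1 = <⇒≈⇒≡ (inverse<p x) y<p (begin
    inverse x               ≡⟨ *-identityˡ (inverse x) ⟨
    1 * inverse x           ≈⟨ *-cong xy≈1 (refl {x = inverse x % p}) ⟨
    x * y * inverse x       ≡⟨ trans (cong (_* inverse x) (*-comm x y)) (*-assoc y x (inverse x)) ⟩
    y * (x * inverse x)     ≈⟨ *-congˡ y (*-inverse 1≤x x<p) ⟩
    y * 1                   ≡⟨ *-identityʳ y ⟩
    y                       ∎)

  1≤inverse : ∀ {x} → 1 ≤ x → x < p → 1 ≤ inverse x
  1≤inverse {x} 1≤x x<p = n≢0⇒n>0 (λ inv≡0 → 1≉0 (begin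
    1                       ≈⟨ *-inverse 1≤x x<p ⟨
    x * inverse x           ≡⟨ cong (x *_) inv≡0 ⟩
    x * 0                   ≡⟨ *-zeroʳ x ⟩
    0                       ∎))

  inverse-involutive : ∀ {x} → 1 ≤ x → x < p → inverse (inverse x) ≡ x
  inverse-involutive {x} 1≤x x<p = inverse-unique (1≤inverse 1≤x x<p) (inverse<p x) x<p
    (trans (≡⇒≈ (*-comm (inverse x) x)) (*-inverse 1≤x x<p))

module Wilson (p : ℕ) .{{_ : NonZero p}} (p-prime : Prime p) {m} (p≡3+m : p ≡ 3 + m) where

  open Congruence p
  open ModularInverse p p-prime
  open ProductCongruence p
  open Product
  open ≈-Reasoning

  <3+m⇒<p : ∀ {x} → x < 3 + m → x < p
  <3+m⇒<p {x} = subst (x <_) (sym p≡3+m)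

  p∸1≡2+m : p ∸ 1 ≡ 2 + m
  p∸1≡2+m = cong pred p≡3+m

  suc-∈ : ∀ {i} → i ∈[1, m ] → 1 ≤ suc i × suc i < p
  suc-∈ (_ , i≤m) = s≤s z≤n , <3+m⇒<p (s≤s (s≤s (m≤n⇒m≤1+n i≤m)))

  inverse-1 : inverse 1 ≡ 1
  inverse-1 = inverse-unique ≤-refl 1<p 1<p refl

  inverse-[p-1] : inverse (2 + m) ≡ 2 + m
  inverse-[p-1] = inverse-unique (s≤s z≤n) 2+m<p 2+m<p
    (subst (λ q → q * q ≈ 1) p∸1≡2+m (∸-*-∸ {1} {1} (>-nonZero⁻¹ p) (>-nonZero⁻¹ p)))
    where 2+m<p = <3+m⇒<p ≤-refl

  inverse-suc-range : ∀ {i} → i ∈[1, m ] → 2 ≤ inverse (suc i) × inverse (suc i) ≤ suc m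
  inverse-suc-range {i} i∈@(1≤i , i≤m) =
    ≤∧≢⇒< (1≤inverse 1≤x x<p) (λ 1≡y → <⇒≢ 1≤i (sym (suc-injective (x≡inverse-of (sym 1≡y) inverse-1)))) ,
    ≤-pred (≤∧≢⇒< (≤-pred (subst (inverse (suc i) <_) p≡3+m (inverse<p (suc i))))
                  (λ y≡2+m → <⇒≢ (s≤s (s≤s i≤m)) (x≡inverse-of y≡2+m inverse-[p-1])))
    where
    1≤x : 1 ≤ suc i
    1≤x = proj₁ (suc-∈ i∈)
    x<p : suc i < p
    x<p = proj₂ (suc-∈ i∈)
    x≡inverse-of : ∀ {c} → inverse (suc i) ≡ c → inverse c ≡ c → suc i ≡ c
    x≡inverse-of {c} y≡c c-fixed = trans (sym (inverse-involutive 1≤x x<p)) (trans (cong inverse y≡c) c-fixed)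

  -- x ↦ x⁻¹ restricted to {2, …, p - 2}, shifted down to [1, m].
  τ : ℕ → ℕ
  τ i = pred (inverse (suc i))

  suc-τ : ∀ {i} → i ∈[1, m ] → suc (τ i) ≡ inverse (suc i)
  suc-τ i∈ = suc-pred _ {{>-nonZero (≤-trans (s≤s z≤n) (proj₁ (inverse-suc-range i∈)))}}

  no-square-root-of-1 : ∀ {i} → i ∈[1, m ] → suc i * suc i ≉ 1
  no-square-root-of-1 {i} (1≤i , i≤m) [i+1]²≈1 =
    [ <⇒≉0 1≤i (<3+m⇒<p (s≤s (m≤n⇒m≤1+n (m≤n⇒m≤1+n i≤m)))) ∘ ∣⇒≈0
    , <⇒≉0 (subst (0 <_) (+-comm 2 i) z<s)
           (<3+m⇒<p (subst (_< 3 + m) (+-comm 2 i) (s≤s (s≤s (s≤s i≤m))))) ∘ ∣⇒≈0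
    ]′ (euclidsLemma i (i + 2) p-prime (≈0⇒∣ i[i+2]≈0))
    where
    open +-*-Solver
    i[i+2]+1≡[i+1]² : ∀ i → i * (i + 2) + 1 ≡ suc i * suc i
    i[i+2]+1≡[i+1]² = solve 1 (λ i → i :* (i :+ con 2) :+ con 1 := (con 1 :+ i) :* (con 1 :+ i)) refl
    i[i+2]≈0 : i * (i + 2) ≈ 0
    i[i+2]≈0 = +-cancelʳ 1 (trans (≡⇒≈ (i[i+2]+1≡[i+1]² i)) [i+1]²≈1)

  τ-isFixedPointFreeInvolutionOn : IsFixedPointFreeInvolutionOn m τ
  τ-isFixedPointFreeInvolutionOn = record
    { isInvolutionOn = record
      { maps-into  = λ i∈ → let (2≤y , y≤1+m) = inverse-suc-range i∈ in pred-mono-≤ 2≤y , pred-mono-≤ y≤1+m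
      ; involutive = λ i∈ → trans (cong (pred ∘ inverse) (suc-τ i∈))
                                  (cong pred (uncurry inverse-involutive (suc-∈ i∈)))
      }
    ; fixedPointFree = λ {i} i∈ τi≡i →
        no-square-root-of-1 i∈ (trans (*-congˡ (suc i) (≡⇒≈ (sym (trans (sym (suc-τ i∈)) (cong suc τi≡i)))))
                                      (uncurry *-inverse (suc-∈ i∈)))
    }

  ∏-2⋯[p-2]≈1 : ∏ m suc ≈ 1
  ∏-2⋯[p-2]≈1 = begin
    ∏ m suc                                           ≡⟨ ∏-pairUp τ-isFixedPointFreeInvolutionOn suc ⟩
    ∏ m (λ i → when (i <ᵇ τ i) (suc i * suc (τ i)))  ≈⟨ ∏-≈1 m (λ {i} i∈ → when-≈1 (i <ᵇ τ i) (pair≈1 i∈)) ⟩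
    1                                                 ∎
    where
    pair≈1 : ∀ {i} → i ∈[1, m ] → suc i * suc (τ i) ≈ 1
    pair≈1 {i} i∈ = trans (≡⇒≈ (cong (suc i *_) (suc-τ i∈))) (uncurry *-inverse (suc-∈ i∈))

  wilson : (p ∸ 1) ! + 1 ≈ 0
  wilson = begin
    (p ∸ 1) ! + 1                             ≡⟨ cong (λ n → n ! + 1) p∸1≡2+m ⟩
    (2 + m) ! + 1                             ≡⟨ cong (_+ 1) (n!≡∏ (2 + m)) ⟩
    ∏ (1 + suc m) (λ i → i) + 1               ≡⟨ cong (_+ 1) (∏-split 1 (suc m) (λ i → i)) ⟩
    1 * (∏ m suc * (2 + m)) + 1               ≡⟨ cong (_+ 1) (*-identityˡ (∏ m suc * (2 + m))) ⟩
    ∏ m suc * (2 + m) + 1                     ≈⟨ +-congʳ 1 (*-cong ∏-2⋯[p-2]≈1 (refl {x = (2 + m) % p})) ⟩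
    1 * (2 + m) + 1                           ≡⟨ cong (_+ 1) (*-identityˡ (2 + m)) ⟩
    2 + m + 1                                 ≡⟨ +-comm (2 + m) 1 ⟩
    3 + m                                     ≡⟨ p≡3+m ⟨
    p                                         ≈⟨ p≈0 ⟩
    0                                         ∎

wilson : ∀ p .{{_ : NonZero p}} → Prime p → Congruence._≈_ p ((p ∸ 1) ! + 1) 0
wilson 0                   p-prime = contradiction (nonTrivial⇒n>1 0 {{prime⇒nonTrivial p-prime}}) λ ()
wilson 1                   p-prime = contradiction (nonTrivial⇒n>1 1 {{prime⇒nonTrivial p-prime}}) (<-irrefl refl)
wilson 2                   _       = refl
wilson (suc (suc (suc m))) p-prime = Wilson.wilson _ p-prime refl

module HalfFactorial (p : ℕ) .{{_ : NonZero p}} (p-prime : Prime p) {k}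
                     (p≡1+4k : p ≡ suc ((k + k) + (k + k))) where

  open Congruence p
  open ProductCongruence p
  open Product
  open ≈-Reasoning

  h : ℕ
  h = k + k

  ρ-isInvolutionOn : IsInvolutionOn h (suc h ∸_)
  ρ-isInvolutionOn = record
    { maps-into  = λ (1≤i , i≤h) → m<n⇒0<n∸m (s≤s i≤h) , ∸-monoʳ-≤ (suc h) 1≤i
    ; involutive = λ (_ , i≤h) → m∸[m∸n]≡n (m≤n⇒m≤1+n i≤h)
    }

  ∏-upper-half : ∏ h (h +_) ≈ ∏ h (λ i → i)
  ∏-upper-half = begin
    ∏ h (h +_)                       ≡⟨ ∏-reindex ρ-isInvolutionOn (h +_) ⟨
    ∏ h (λ i → h + (suc h ∸ i))      ≡⟨ ∏-cong h (λ {i} (_ , i≤h) → h+[1+h∸i]≡p∸i i≤h) ⟩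
    ∏ h (p ∸_)                       ≈⟨ ∏-∸-even k h≤p ⟩
    ∏ h (λ i → i)                    ∎
    where
    h+[1+h∸i]≡p∸i : ∀ {i} → i ≤ h → h + (suc h ∸ i) ≡ p ∸ i
    h+[1+h∸i]≡p∸i {i} i≤h =
      trans (sym (+-∸-assoc h (m≤n⇒m≤1+n i≤h))) (cong (_∸ i) (trans (+-suc h h) (sym p≡1+4k)))
    h≤p : h ≤ p
    h≤p = subst (h ≤_) (sym p≡1+4k) (≤-trans (m≤m+n h h) (n≤1+n (h + h)))

  h!²+1≈0 : h ! * h ! + 1 ≈ 0
  h!²+1≈0 = begin
    h ! * h ! + 1                             ≡⟨ cong (_+ 1) (cong₂ _*_ (n!≡∏ h) (n!≡∏ h)) ⟩
    ∏ h (λ i → i) * ∏ h (λ i → i) + 1         ≈⟨ +-congʳ 1 (*-congˡ (∏ h (λ i → i)) ∏-upper-half) ⟨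
    ∏ h (λ i → i) * ∏ h (h +_) + 1            ≡⟨ cong (_+ 1) (∏-split h h (λ i → i)) ⟨
    ∏ (h + h) (λ i → i) + 1                   ≡⟨ cong (_+ 1) (n!≡∏ (h + h)) ⟨
    (h + h) ! + 1                             ≡⟨ cong (λ n → pred n ! + 1) p≡1+4k ⟨
    (p ∸ 1) ! + 1                             ≈⟨ wilson p p-prime ⟩
    0                                         ∎

module HalfSystem (p : ℕ) .{{_ : NonZero p}} {h} (p≡1+2h : p ≡ suc (h + h)) where

  open Congruence p

  ≤h⇒<p : ∀ {u} → u ≤ h → u < p
  ≤h⇒<p {u} u≤h = subst (u <_) (sym p≡1+2h) (s≤s (≤-trans u≤h (m≤m+n h h)))

  ∈[1,h]⇒≉0 : ∀ {u} → u ∈[1, h ] → u ≉ 0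
  ∈[1,h]⇒≉0 (1≤u , u≤h) = <⇒≉0 1≤u (≤h⇒<p u≤h)

  +-≉0 : ∀ {u v} → u ∈[1, h ] → v ∈[1, h ] → u + v ≉ 0
  +-≉0 (1≤u , u≤h) (_ , v≤h) =
    <⇒≉0 (≤-trans 1≤u (m≤m+n _ _)) (subst (_ <_) (sym p≡1+2h) (s≤s (+-mono-≤ u≤h v≤h)))

  ≈±-injective : ∀ {u v} → u ∈[1, h ] → v ∈[1, h ] → u ≈± v → u ≡ v
  ≈±-injective (_ , u≤h) (_ , v≤h) (inj₁ u≈v)   = <⇒≈⇒≡ (≤h⇒<p u≤h) (≤h⇒<p v≤h) u≈v
  ≈±-injective u∈        v∈        (inj₂ u+v≈0) = contradiction u+v≈0 (+-≉0 u∈ v∈)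

  tilde-≈± : ∀ y → y ≈± tilde p y
  tilde-≈± y with p <ᵇ 2 * (y % p)
  ... | false = inj₁ (sym (%-≈ y))
  ... | true  = inj₂ (begin
    y + (p ∸ y % p)       ≈⟨ +-congʳ (p ∸ y % p) (%-≈ y) ⟨
    y % p + (p ∸ y % p)   ≡⟨ m+[n∸m]≡n (m%n≤n y p) ⟩
    p                     ≈⟨ p≈0 ⟩
    0                     ∎)
    where open ≈-Reasoning

  tilde-range : ∀ {y} → y ≉ 0 → tilde p y ∈[1, h ]
  tilde-range {y} y≉0 with p <ᵇ 2 * (y % p) | <ᵇ-reflects-< p (2 * (y % p))
  ... | false | ofⁿ p≮2r = n≢0⇒n>0 (λ r≡0 → y≉0 (trans r≡0 (sym 0%p≡0))) ,
                           m+m≤1+n+n⇒m≤n (subst₂ _≤_ (2*m≡m+m (y % p)) p≡1+2h (≮⇒≥ p≮2r))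
  ... | true  | ofʸ p<2r = m<n⇒0<n∸m (m%n<n y p) , (begin
    p ∸ y % p             ≤⟨ ∸-monoʳ-≤ p (1+n+n<m+m⇒n<m {y % p} (subst₂ _<_ p≡1+2h (2*m≡m+m (y % p)) p<2r)) ⟩
    p ∸ suc h             ≡⟨ cong (_∸ suc h) p≡1+2h ⟩
    h + h ∸ h             ≡⟨ m+n∸n≡m h h ⟩
    h                     ∎)
    where open ≤-Reasoning

  tilde-unique : ∀ {x y} → x ∈[1, h ] → y ≈± x → tilde p y ≡ x
  tilde-unique {y = y} x∈ y≈±x =
    ≈±-injective (tilde-range (≈±-≉0 (∈[1,h]⇒≉0 x∈) y≈±x)) x∈ (≈±-trans (≈±-sym (tilde-≈± y)) y≈±x)

module SquareRootOfMinusOne (p : ℕ) .{{_ : NonZero p}} (p-prime : Prime p) {h} (p≡1+2h : p ≡ suc (h + h))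
                            {t} (t²+1≈0 : Congruence._≈_ p (t * t + 1) 0) where

  open Congruence p
  open HalfSystem p {h} p≡1+2h

  σ : ℕ → ℕ
  σ x = tilde p (t * x)

  t[tx]+x≈0 : ∀ x → t * (t * x) + x ≈ 0
  t[tx]+x≈0 x = begin
    t * (t * x) + x       ≡⟨ cong₂ _+_ (*-assoc t t x) (*-identityˡ x) ⟨
    t * t * x + 1 * x     ≡⟨ *-distribʳ-+ x (t * t) 1 ⟨
    (t * t + 1) * x       ≈⟨ *-cong t²+1≈0 (refl {x = x % p}) ⟩
    0                     ∎
    where open ≈-Reasoning

  tx≉0 : ∀ {x} → x ∈[1, h ] → t * x ≉ 0
  tx≉0 {x} x∈ tx≈0 with euclidsLemma t x p-prime (≈0⇒∣ tx≈0)
  ... | inj₂ p∣x = ∈[1,h]⇒≉0 x∈ (∣⇒≈0 p∣x)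
  ... | inj₁ p∣t = ∈[1,h]⇒≉0 (s≤s z≤n , ≤-trans (proj₁ x∈) (proj₂ x∈)) (begin
    1                     ≈⟨ +-congʳ 1 (*-cong (∣⇒≈0 p∣t) (refl {x = t % p})) ⟨
    t * t + 1             ≈⟨ t²+1≈0 ⟩
    0                     ∎)
    where open ≈-Reasoning

  t[tx]≈x : ∀ {x} → t * x ≈± x → t * (t * x) ≈ x
  t[tx]≈x {x} (inj₁ tx≈x)   = trans (*-congˡ t tx≈x) tx≈x
  t[tx]≈x {x} (inj₂ tx+x≈0) = +-cancelʳ (t * x) (begin
    t * (t * x) + t * x   ≡⟨ *-distribˡ-+ t (t * x) x ⟨
    t * (t * x + x)       ≈⟨ *-congˡ t tx+x≈0 ⟩
    t * 0                 ≡⟨ *-zeroʳ t ⟩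
    0                     ≈⟨ tx+x≈0 ⟨
    t * x + x             ≡⟨ +-comm (t * x) x ⟩
    x + t * x             ∎)
    where open ≈-Reasoning

  σ-isFixedPointFreeInvolutionOn : IsFixedPointFreeInvolutionOn h σ
  σ-isFixedPointFreeInvolutionOn = record
    { isInvolutionOn = record
      { maps-into  = tilde-range ∘ tx≉0
      ; involutive = λ {x} x∈ →
          tilde-unique x∈ (≈±-trans (≈±-sym (≈±-*ˡ t (tilde-≈± (t * x)))) (inj₂ (t[tx]+x≈0 x)))
      }
    ; fixedPointFree = λ {x} x∈ σx≡x →
        +-≉0 x∈ x∈ (trans (+-congʳ x (sym (t[tx]≈x (subst (t * x ≈±_) σx≡x (tilde-≈± (t * x))))))
                          (t[tx]+x≈0 x))
    }

k*4≡4k : ∀ k → k * 4 ≡ (k + k) + (k + k)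
k*4≡4k = solve 1 (λ k → k :* con 4 := (k :+ k) :+ (k :+ k)) refl
  where open +-*-Solver

p%4≡1⇒p≡1+4k : ∀ {p} → p % 4 ≡ 1 → p ≡ suc ((p / 4 + p / 4) + (p / 4 + p / 4))
p%4≡1⇒p≡1+4k {p} p%4≡1 = trans (m≡m%n+[m/n]*n p 4) (cong₂ _+_ p%4≡1 (k*4≡4k (p / 4)))

half-1+4k : ∀ k → half (suc ((k + k) + (k + k))) ≡ k + k
half-1+4k k = trans (cong (_/ 2) (trans (sym (2*m≡m+m (k + k))) (*-comm 2 (k + k)))) (m*n/n≡m (k + k) 2)

quarter-1+4k : ∀ k → (suc ((k + k) + (k + k)) ∸ 1) / 4 ≡ k
quarter-1+4k k = trans (cong (_/ 4) (sym (k*4≡4k k))) (m*n/n≡m k 4)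

module InversionsOfHalfFactorial (p : ℕ) .{{_ : NonZero p}} (p-prime : Prime p) {k}
                                 (p≡1+4k : p ≡ suc ((k + k) + (k + k))) where

  open Congruence p
  open Sum

  half-p≡2k : half p ≡ k + k
  half-p≡2k = trans (cong half p≡1+4k) (half-1+4k k)

  p≡1+2h : p ≡ suc (half p + half p)
  p≡1+2h = trans p≡1+4k (cong suc (cong₂ _+_ (sym half-p≡2k) (sym half-p≡2k)))

  t²+1≈0 : tfac p * tfac p + 1 ≈ 0
  t²+1≈0 = subst (λ h → h ! * h ! + 1 ≈ 0) (sym half-p≡2k) (HalfFactorial.h!²+1≈0 p p-prime {k} p≡1+4k)

  open SquareRootOfMinusOne p p-prime {half p} p≡1+2h {tfac p} t²+1≈0 using (σ-isFixedPointFreeInvolutionOn)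
  open InvolutionInversions σ-isFixedPointFreeInvolutionOn

  gamma≡ : gamma (tfac p) p ≡ 4 * cardZ (tfac p) p + 2 * cardX (tfac p) p + k
  gamma≡ = begin
    gamma (tfac p) p
      ≡⟨ length-filter-pairs _ (half p) ⟩
    ∑∑ (half p) inverted
      ≡⟨ ∑∑-inverted ⟩
    4 * ∑∑ (half p) nested + 2 * ∑∑ (half p) crossing + cardV
      ≡⟨ cong₂ _+_ (cong₂ (λ z x → 4 * z + 2 * x) (sym (length-filter-pairs _ (half p)))
                                                  (sym (length-filter-pairs _ (half p))))
                   (m+m≡n+n⇒m≡n (trans cardV+cardV half-p≡2k)) ⟩
    4 * cardZ (tfac p) p + 2 * cardX (tfac p) p + k
      ∎
    where open ≡-Reasoning

theorem3p2 : (p : ℕ) → .{{_ : NonZero p}} → Prime p → p % 4 ≡ 1 →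
    gamma (tfac p) p ≡ 4 * cardZ (tfac p) p + 2 * cardX (tfac p) p + (p ∸ 1) / 4
theorem3p2 p p-prime p%4≡1 =
  trans (InversionsOfHalfFactorial.gamma≡ p p-prime p≡1+4k)
        (cong (4 * cardZ (tfac p) p + 2 * cardX (tfac p) p +_)
              (sym (trans (cong (λ q → (q ∸ 1) / 4) p≡1+4k) (quarter-1+4k (p / 4)))))
  where
  p≡1+4k : p ≡ suc ((p / 4 + p / 4) + (p / 4 + p / 4))
  p≡1+4k = p%4≡1⇒p≡1+4k p%4≡1
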